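{- Let $p\geq3$ be prime and $r\geq1$. For any $1\leq s<p^r$, $$\mathfrak{H}_{p^r}^{(s)}(p)\equiv0\pmod{p^{r-\eta_s}},\qquad\text{where }\eta_s=\Big\lfloor\frac{s}{p-1}\Big\rfloor+\nu_p\Big(\Big\lfloor\frac{s}{p-1}\Big\rfloor!\Big).$$
   Context: $\mathfrak{H}_n^{(s)}(p)=\sum_{1\leq k_1<k_2<\cdots<k_s\leq n,\ p\nmid k_1\cdots k_s}\frac{1}{k_1\cdots k_s}$. $\nu_p$ is the $p$-adic valuation. -}

module Defs where

open import Data.Nat using (ℕ; zero; suc; _+_; _*_; _∸_; _^_; _/_; _%_; _≟_; _!)
open import Data.Nat.Divisibility using (_∣_; _∣?_)

open import Data.List using (List; []; _∷_; _++_; map; filter; foldr)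
open import Data.List.Relation.Unary.All using (All; all?)
open import Data.Integer using (ℤ; +_)
import Data.Integer as ℤ
open import Data.Rational using (ℚ; 0ℚ; 1ℚ; ↥_; ↧ₙ_)
import Data.Rational as ℚ
open import Data.Product using (_×_)
open import Relation.Nullary using (¬_; ¬?)

-- All s-element subsets of {1,…,n}, each listed as a (strictly decreasing) list.
subsets : ℕ → ℕ → List (List ℕ)
subsets n zero = [] ∷ []
subsets zero (suc s) = []
subsets (suc n) (suc s) = subsets n (suc s) ++ map (suc n ∷_) (subsets n s)

-- 1/k as a rational (only ever applied to k ≥ 1).
recip : ℕ → ℚ
recip zero = 0ℚ
recip (suc k) = (+ 1) ℚ./ suc k

recipProd : List ℕ → ℚ
recipProd = foldr (λ k q → recip k ℚ.* q) 1ℚ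

sumℚ : List ℚ → ℚ
sumℚ = foldr ℚ._+_ 0ℚ

-- 𝔥_n^{(s)}(p) = Σ_{1 ≤ k₁ < … < k_s ≤ n, p ∤ k₁⋯k_s} 1/(k₁⋯k_s)
-- (p ∤ k₁⋯k_s for prime p is spelled as p ∤ kᵢ for every i)
H : ℕ → ℕ → ℕ → ℚ
H p n s = sumℚ (map recipProd
  (filter (all? (λ k → ¬? (p ∣? k))) (subsets n s)))

-- p-adic valuation ν_p(n) of n ≥ 1 (p ≥ 2; junk value 0 for p < 2 or n = 0)
ν : ℕ → ℕ → ℕ
ν zero n = 0
ν (suc zero) n = 0
ν (suc (suc q)) n = go n n
  where
  go : ℕ → ℕ → ℕ
  go zero m = 0
  go (suc f) zero = 0
  go (suc f) (suc m) with (suc m) % suc (suc q) ≟ 0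
  ... | Relation.Nullary.yes _ = suc (go f (suc m / suc (suc q)))
  ... | Relation.Nullary.no _ = 0

-- η_s = ⌊s/(p-1)⌋ + ν_p(⌊s/(p-1)⌋!)   (p ≥ 2; junk value 0 otherwise)
η : ℕ → ℕ → ℕ
η zero s = 0
η (suc zero) s = 0
η (suc (suc q)) s = (s / suc q) + ν (suc (suc q)) ((s / suc q) !)

-- x ≡ 0 (mod p^k) for a rational x: x ∈ p^k ℤ_(p), i.e. in lowest terms
-- p^k divides the numerator and p does not divide the denominator.
ZeroMod : ℕ → ℕ → ℚ → Set
ZeroMod p k x = (p ^ k) ∣ ℤ.∣ ↥ x ∣ × ¬ (p ∣ ↧ₙ x)

-- Let S be the list of integers in [1, p^r] prime to p and N its length, so that H = e_s(1/k : k ∈ S).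
-- Multiplying by the p-adic unit ∏ S turns H into the integer e_{N-s}(S). For a unit u, k ↦ uk mod p^r
-- permutes S, so e_t(S) ≡ u^t e_t(S) (mod p^r); with Euler's theorem u^N ≡ 1 this gives
-- (u^s - 1) e_{N-s}(S) ≡ 0 (mod p^r). It remains to find a unit u with ν_p(u^s - 1) ≤ ⌊s/(p-1)⌋.
-- If p - 1 ∤ s then u^s ≡ u^t for t = s mod (p - 1), and some u ≤ t + 1 has u^t ≢ 1 (mod p), since
-- otherwise p would divide the t-th finite difference of x^t, which is t!. If p - 1 ∣ s, lifting the
-- exponent for odd p gives ν_p((1 + p)^s - 1) = 1 + ν_p(s) ≤ ⌊s/(p-1)⌋.

module Submission where

open import Defs
open import Data.Nat using (ℕ; _≤_; _<_; _^_; _∸_)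
open import Data.Nat.Primality using (Prime)
open import Data.Nat using (suc)

module PrimeDivisibility where

  open import Data.Nat
  open import Data.Nat.Properties
  open import Data.Nat.Divisibility
  open import Data.Nat.Primality
  open import Data.Nat.Coprimality using (Coprime; coprime-divisor)
  open import Data.Nat.DivMod using (m%n<n; m≡m%n+[m/n]*n)
  open import Data.Nat.Induction using (<-rec)
  open import Data.Nat.ListAction using (product)
  open import Data.Nat.Tactic.RingSolver using (solve-∀)
  open import Data.List.Relation.Unary.All using (All; []; _∷_)
  open import Data.Product using (Σ; _×_; _,_)
  open import Data.Sum using (inj₁; inj₂)
  open import Relation.Nullary using (¬_; yes; no; contradiction)
  open import Relation.Binary.PropositionalEquality

  m^n∣m^o : ∀ m {n o} → n ≤ o → m ^ n ∣ m ^ o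
  m^n∣m^o m {n} {o} n≤o = divides (m ^ (o ∸ n))
    (trans (cong (m ^_) (sym (m∸n+n≡m n≤o))) (^-distribˡ-+-* m (o ∸ n) n))

  n<m^n : ∀ {m} → 1 < m → ∀ n → n < m ^ n
  n<m^n 1<m zero = s≤s z≤n
  n<m^n {m@(suc _)} 1<m (suc n) = begin-strict
    suc n      ≤⟨ n<m^n 1<m n ⟩
    m ^ n      <⟨ m<m*n (m ^ n) m 1<m ⟩
    m ^ n * m  ≡⟨ *-comm (m ^ n) m ⟩
    m * m ^ n  ∎
    where
    open ≤-Reasoning
    instance
      m^n≢0′ : NonZero (m ^ n)
      m^n≢0′ = m^n≢0 m n

  module _ {p : ℕ} (p-prime : Prime p) where

    private instance
      p≢0 : NonZero p
      p≢0 = prime⇒nonZero p-prime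

    odd-prime : 3 ≤ p → Σ ℕ λ h → p ≡ suc (2 * h)
    odd-prime 3≤p = odd (p % 2) (m%n<n p 2) (m≡m%n+[m/n]*n p 2)
      where
      odd : ∀ b → b < 2 → p ≡ b + p / 2 * 2 → Σ ℕ λ h → p ≡ suc (2 * h)
      odd zero _ p≡[p/2]*2 with prime⇒irreducible p-prime (divides (p / 2) p≡[p/2]*2)
      ... | inj₂ 2≡p = contradiction (subst (3 ≤_) (sym 2≡p) 3≤p) λ { (s≤s (s≤s ())) }
      odd (suc zero) _ p≡1+[p/2]*2 = p / 2 , trans p≡1+[p/2]*2 (cong suc (*-comm (p / 2) 2))
      odd (suc (suc _)) (s≤s (s≤s ())) _

    p∤1 : ¬ p ∣ 1
    p∤1 p∣1 = ¬prime[1] (subst Prime (∣1⇒≡1 p∣1) p-prime)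

    p∤m*n : ∀ {m n} → ¬ p ∣ m → ¬ p ∣ n → ¬ p ∣ m * n
    p∤m*n {m} {n} p∤m p∤n p∣mn with euclidsLemma m n p-prime p∣mn
    ... | inj₁ p∣m = p∤m p∣m
    ... | inj₂ p∣n = p∤n p∣n

    p∤m^n : ∀ {m} → ¬ p ∣ m → ∀ n → ¬ p ∣ m ^ n
    p∤m^n p∤m zero = p∤1
    p∤m^n p∤m (suc n) = p∤m*n p∤m (p∤m^n p∤m n)

    p∤product : ∀ {ks} → All (λ k → ¬ p ∣ k) ks → ¬ p ∣ product ks
    p∤product [] = p∤1
    p∤product (p∤k ∷ p∤ks) = p∤m*n p∤k (p∤product p∤ks)

    p^k∣m*n⇒p^k∣n : ∀ {m} → ¬ p ∣ m → ∀ k {n} → p ^ k ∣ m * n → p ^ k ∣ n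
    p^k∣m*n⇒p^k∣n p∤m zero _ = 1∣ _
    p^k∣m*n⇒p^k∣n {m} p∤m (suc k) {n} p^k+1∣mn with euclidsLemma m n p-prime (∣-trans (m∣m*n (p ^ k)) p^k+1∣mn)
    ... | inj₁ p∣m = contradiction p∣m p∤m
    ... | inj₂ (divides n′ refl) =
      subst (_∣ n′ * p) (*-comm (p ^ k) p) (*-monoˡ-∣ p (p^k∣m*n⇒p^k∣n p∤m k p^k∣mn′))
      where
      p^k∣mn′ : p ^ k ∣ m * n′
      p^k∣mn′ = *-cancelʳ-∣ p (subst₂ _∣_ (*-comm p (p ^ k)) (sym (*-assoc m n′ p)) p^k+1∣mn)

    p∤m⇒coprime[m,p^k] : ∀ {m} → ¬ p ∣ m → ∀ k → Coprime m (p ^ k)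
    p∤m⇒coprime[m,p^k] p∤m zero (_ , d∣1) = ∣1⇒≡1 d∣1
    p∤m⇒coprime[m,p^k] {m} p∤m (suc k) {d} (d∣m , d∣p^k+1) =
      p∤m⇒coprime[m,p^k] p∤m k (d∣m , coprime-divisor coprime[d,p] d∣p^k+1)
      where
      coprime[d,p] : Coprime d p
      coprime[d,p] (e∣d , e∣p) with prime⇒irreducible p-prime e∣p
      ... | inj₁ e≡1 = e≡1
      ... | inj₂ refl = contradiction (∣-trans e∣d d∣m) p∤m

    p-adic-decomposition : ∀ s → 1 ≤ s → Σ ℕ λ a → Σ ℕ λ b → s ≡ p ^ a * b × ¬ p ∣ b
    p-adic-decomposition = <-rec _ decompose
      where
      decompose : ∀ s → (∀ {s′} → s′ < s → 1 ≤ s′ → Σ ℕ λ a → Σ ℕ λ b → s′ ≡ p ^ a * b × ¬ p ∣ b) →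
                  1 ≤ s → Σ ℕ λ a → Σ ℕ λ b → s ≡ p ^ a * b × ¬ p ∣ b
      decompose s rec 1≤s with p ∣? s
      ... | no p∤s = 0 , s , sym (*-identityˡ s) , p∤s
      ... | yes (divides zero refl) = contradiction 1≤s λ ()
      ... | yes (divides (suc q) refl) =
        let (a , b , q+1≡p^a*b , p∤b) = rec (m<m*n (suc q) p (nonTrivial⇒n>1 p {{prime⇒nonTrivial p-prime}})) (s≤s z≤n)
        in suc a , b , trans (cong (_* p) q+1≡p^a*b) (reassociate (p ^ a) b p) , p∤b
        where
        reassociate : ∀ x b p → x * b * p ≡ p * x * b
        reassociate = solve-∀

    p∣n!⇒p≤n : ∀ n → p ∣ n ! → p ≤ n
    p∣n!⇒p≤n zero p∣1 = contradiction p∣1 p∤1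
    p∣n!⇒p≤n (suc n) p∣n+1! with euclidsLemma (suc n) (n !) p-prime p∣n+1!
    ... | inj₁ p∣n+1 = ∣⇒≤ p∣n+1
    ... | inj₂ p∣n! = m≤n⇒m≤1+n (p∣n!⇒p≤n n p∣n!)

module IntegerDivisibility where

  open import Data.Nat as ℕ using (ℕ; zero; suc; _/_; _%_; NonZero)
  import Data.Nat.Properties as ℕ
  open import Data.Nat.Divisibility as ℕᵈ using (_∣_)
  open import Data.Nat.DivMod using (m≡m%n+[m/n]*n; [m+kn]%n≡m%n)
  open import Data.Nat.Primality using (Prime; prime⇒nonZero)
  open import Data.Nat.Coprimality using (coprime-Bézout)
  open import Data.Nat.GCD using (module Bézout)
  open import Data.Integer using (ℤ; +_; -[1+_]; 0ℤ; 1ℤ; _+_; _-_; _*_; -_; ∣_∣) renaming (_^_ to _^ᶻ_)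
  open import Data.Integer.Properties
  open import Data.Integer.Divisibility.Signed as ℤᵈ using (divides) renaming (_∣_ to _∣ᶻ_)
  open import Data.Integer.Tactic.RingSolver using (solve-∀)
  open import Data.Product using (Σ; _,_)
  open import Data.Sum using (inj₁; inj₂)
  open import Relation.Nullary using (¬_)
  open import Relation.Binary.PropositionalEquality
  open ≡-Reasoning

  open PrimeDivisibility

  ∣x-1⇒∣x^n-1 : ∀ {m x} → m ∣ᶻ x - 1ℤ → ∀ n → m ∣ᶻ x ^ᶻ n - 1ℤ
  ∣x-1⇒∣x^n-1 m∣x-1 zero = divides 0ℤ refl
  ∣x-1⇒∣x^n-1 {m} {x} m∣x-1 (suc n) = subst (m ∣ᶻ_) (telescope x (x ^ᶻ n))
    (ℤᵈ.∣m∣n⇒∣m+n (ℤᵈ.∣n⇒∣m*n x (∣x-1⇒∣x^n-1 m∣x-1 n)) m∣x-1)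
    where
    telescope : ∀ x y → x * (y - 1ℤ) + (x - 1ℤ) ≡ x * y - 1ℤ
    telescope = solve-∀

  pos-^ : ∀ u t → + (u ℕ.^ t) ≡ (+ u) ^ᶻ t
  pos-^ u zero = refl
  pos-^ u (suc t) = trans (pos-* u (u ℕ.^ t)) (cong (+ u *_) (pos-^ u t))

  pos-+*≡ : ∀ a b c → + (a ℕ.+ b ℕ.* c) ≡ + a + + b * + c
  pos-+*≡ a b c = trans (pos-+ a (b ℕ.* c)) (cong (_+_ (+ a)) (pos-* b c))

  n∣m%n-m : ∀ m n .{{_ : NonZero n}} → + n ∣ᶻ + (m % n) - + m
  n∣m%n-m m n = divides (- + (m / n)) (begin
    + (m % n) - + m                              ≡⟨ cong (λ k → + (m % n) - + k) (m≡m%n+[m/n]*n m n) ⟩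
    + (m % n) - + (m % n ℕ.+ m / n ℕ.* n)        ≡⟨ cong (λ k → + (m % n) - k) (pos-+*≡ (m % n) (m / n) n) ⟩
    + (m % n) - (+ (m % n) + + (m / n) * + n)    ≡⟨ x-[x+y*z]≡-y*z (+ (m % n)) (+ (m / n)) (+ n) ⟩
    - + (m / n) * + n                            ∎)
    where
    x-[x+y*z]≡-y*z : ∀ x y z → x - (x + y * z) ≡ - y * z
    x-[x+y*z]≡-y*z = solve-∀

  n∣m-o⇒m%n≡o%n : ∀ {m o} n .{{_ : NonZero n}} → + n ∣ᶻ + m - + o → m % n ≡ o % n
  n∣m-o⇒m%n≡o%n {m} {o} n (divides (+ k) m-o≡k*n) = begin
    m % n              ≡⟨ cong (_% n) (+-injective +m≡+[o+k*n]) ⟩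
    (o ℕ.+ k ℕ.* n) % n ≡⟨ [m+kn]%n≡m%n o k n ⟩
    o % n              ∎
    where
    x≡y+[x-y] : ∀ x y → x ≡ y + (x - y)
    x≡y+[x-y] = solve-∀
    +m≡+[o+k*n] : + m ≡ + (o ℕ.+ k ℕ.* n)
    +m≡+[o+k*n] = trans (x≡y+[x-y] (+ m) (+ o)) (trans (cong (_+_ (+ o)) m-o≡k*n) (sym (pos-+*≡ o k n)))
  n∣m-o⇒m%n≡o%n {m} {o} n (divides -[1+ k ] m-o≡-[1+k]*n) =
    sym (n∣m-o⇒m%n≡o%n n (divides (+ suc k) o-m≡[1+k]*n))
    where
    -[x-y]≡y-x : ∀ x y → - (x - y) ≡ y - x
    -[x-y]≡y-x = solve-∀
    o-m≡[1+k]*n : + o - + m ≡ + suc k * + n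
    o-m≡[1+k]*n = trans (sym (-[x-y]≡y-x (+ m) (+ o)))
                        (trans (cong -_ m-o≡-[1+k]*n) (neg-distribˡ-* -[1+ k ] (+ n)))

  p∤w⇒p∤w+p*k : ∀ {p} w k → ¬ p ∣ ∣ w ∣ → ¬ p ∣ ∣ w + + p * k ∣
  p∤w⇒p∤w+p*k {p} w k p∤w p∣w+pk = p∤w (ℤᵈ.∣⇒∣ᵤ (subst (+ p ∣ᶻ_) (cancel w (+ p * k))
    (ℤᵈ.∣m∣n⇒∣m-n (ℤᵈ.∣ᵤ⇒∣ {+ p} {w + + p * k} p∣w+pk) (ℤᵈ.∣m⇒∣m*n k ℤᵈ.∣-refl))))
    where
    cancel : ∀ x y → x + y - y ≡ x
    cancel = solve-∀

  module _ {p : ℕ} (p-prime : Prime p) where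

    p^k∣w*e⇒p^k∣e : ∀ k {w e} → ¬ p ∣ ∣ w ∣ → + (p ^ k) ∣ᶻ w * e → + (p ^ k) ∣ᶻ e
    p^k∣w*e⇒p^k∣e k {w} {e} p∤w p^k∣we = ℤᵈ.∣ᵤ⇒∣
      (p^k∣m*n⇒p^k∣n p-prime p∤w k (subst (p ^ k ∣_) (abs-* w e) (ℤᵈ.∣⇒∣ᵤ p^k∣we)))

    p^R∣p^d*w*e⇒p^[R∸d]∣e : ∀ R d {w e} → ¬ p ∣ ∣ w ∣ →
                            + (p ^ R) ∣ᶻ + (p ^ d) * w * e → + (p ^ (R ∸ d)) ∣ᶻ e
    p^R∣p^d*w*e⇒p^[R∸d]∣e R d {w} {e} p∤w p^R∣p^dwe with ℕ.≤-total d R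
    ... | inj₂ R≤d rewrite ℕ.m≤n⇒m∸n≡0 R≤d = ℤᵈ.∣ᵤ⇒∣ (ℕᵈ.1∣ _)
    ... | inj₁ d≤R = p^k∣w*e⇒p^k∣e (R ∸ d) {w} p∤w (ℤᵈ.*-cancelˡ-∣ (+ (p ^ d)) p^d*p^[R∸d]∣p^d*we)
      where
      instance
        p≢0 : NonZero p
        p≢0 = prime⇒nonZero p-prime
        p^d≢0 : NonZero (p ^ d)
        p^d≢0 = ℕ.m^n≢0 p d
      p^d*p^[R∸d]∣p^d*we : + (p ^ d) * + (p ^ (R ∸ d)) ∣ᶻ + (p ^ d) * (w * e)
      p^d*p^[R∸d]∣p^d*we = subst₂ _∣ᶻ_
        (trans (cong (λ n → + (p ^ n)) (sym (ℕ.m+[n∸m]≡n d≤R)))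
               (trans (cong +_ (ℕ.^-distribˡ-+-* p d (R ∸ d))) (pos-* (p ^ d) (p ^ (R ∸ d)))))
        (*-assoc (+ (p ^ d)) w e) p^R∣p^dwe

    inverse-mod-p^k : ∀ {u} → ¬ p ∣ u → ∀ k → Σ ℕ λ v → + (p ^ k) ∣ᶻ + u * + v - 1ℤ
    inverse-mod-p^k {u} p∤u k with coprime-Bézout (p∤m⇒coprime[m,p^k] p-prime p∤u k)
    ... | Bézout.+- x y 1+y*p^k≡x*u = x , divides (+ y) (begin
      + u * + x - 1ℤ                  ≡⟨ cong (_- 1ℤ) (trans (*-comm (+ u) (+ x)) (sym (pos-* x u))) ⟩
      + (x ℕ.* u) - 1ℤ                ≡⟨ cong (λ n → + n - 1ℤ) (sym 1+y*p^k≡x*u) ⟩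
      + (1 ℕ.+ y ℕ.* p ^ k) - 1ℤ      ≡⟨ cong (_- 1ℤ) (pos-+*≡ 1 y (p ^ k)) ⟩
      1ℤ + + y * + (p ^ k) - 1ℤ       ≡⟨ [1+a]-1≡a (+ y * + (p ^ k)) ⟩
      + y * + (p ^ k)                 ∎)
      where
      [1+a]-1≡a : ∀ a → 1ℤ + a - 1ℤ ≡ a
      [1+a]-1≡a = solve-∀
    -- here -x is an inverse of u, and x²u ≡ -x is one in ℕ
    ... | Bézout.-+ x y 1+x*u≡y*p^k = x ℕ.* x ℕ.* u , divides ((+ x * + u - 1ℤ) * + y) (begin
      + u * + (x ℕ.* x ℕ.* u) - 1ℤ              ≡⟨ cong (λ z → + u * z - 1ℤ) (trans (pos-* (x ℕ.* x) u) (cong (_* + u) (pos-* x x))) ⟩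
      + u * (+ x * + x * + u) - 1ℤ              ≡⟨ difference-of-squares (+ u) (+ x) ⟩
      (+ x * + u - 1ℤ) * (1ℤ + + x * + u)       ≡⟨ cong ((+ x * + u - 1ℤ) *_) (trans (sym (pos-+*≡ 1 x u)) (trans (cong +_ 1+x*u≡y*p^k) (pos-* y (p ^ k)))) ⟩
      (+ x * + u - 1ℤ) * (+ y * + (p ^ k))      ≡⟨ sym (*-assoc (+ x * + u - 1ℤ) (+ y) (+ (p ^ k))) ⟩
      (+ x * + u - 1ℤ) * + y * + (p ^ k)        ∎)
      where
      difference-of-squares : ∀ u x → u * (x * x * u) - 1ℤ ≡ (x * u - 1ℤ) * (1ℤ + x * u)
      difference-of-squares = solve-∀

module ListPermutation where

  open import Data.List using ([]; _∷_; map)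
  open import Data.List.Membership.Propositional using (_∈_)
  open import Data.List.Membership.Propositional.Properties using (∈-map⁺; ∈-map⁻)
  open import Data.List.Membership.Propositional.Properties.WithK using (unique∧set⇒bag)
  import Data.List.Relation.Unary.All as All
  import Data.List.Relation.Unary.All.Properties as All
  open import Data.List.Relation.Unary.Any using (here; there)
  open import Data.List.Relation.Unary.Unique.Propositional using (Unique; []; _∷_)
  open import Data.List.Relation.Binary.BagAndSetEquality using (∼bag⇒↭)
  open import Data.List.Relation.Binary.Permutation.Propositional using (_↭_)
  open import Data.Product using (Σ; _×_; _,_)
  open import Function.Bundles using (mk⇔)
  open import Relation.Binary.PropositionalEquality

  module _ {A : Set} {f : A → A} where

    map-unique : ∀ {xs} → (∀ {x y} → x ∈ xs → y ∈ xs → f x ≡ f y → x ≡ y) →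
                 Unique xs → Unique (map f xs)
    map-unique inj [] = []
    map-unique inj (x≢xs ∷ xs!) =
      All.map⁺ (All.tabulate (λ y∈xs fx≡fy → All.lookup x≢xs y∈xs (inj (here refl) (there y∈xs) fx≡fy)))
      ∷ map-unique (λ x∈ y∈ → inj (there x∈) (there y∈)) xs!

    bijection⇒map↭ : ∀ {xs} → Unique xs →
                     (∀ {x y} → x ∈ xs → y ∈ xs → f x ≡ f y → x ≡ y) →
                     (∀ {x} → x ∈ xs → f x ∈ xs) →
                     (∀ {y} → y ∈ xs → Σ A λ x → x ∈ xs × f x ≡ y) →
                     map f xs ↭ xs
    bijection⇒map↭ {xs} xs! inj into onto =
      ∼bag⇒↭ (unique∧set⇒bag (map-unique inj xs!) xs! (mk⇔ to from))
      where
      to : ∀ {y} → y ∈ map f xs → y ∈ xs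
      to y∈ with ∈-map⁻ f y∈
      ... | x , x∈xs , refl = into x∈xs
      from : ∀ {y} → y ∈ xs → y ∈ map f xs
      from y∈ with onto y∈
      ... | x , x∈xs , refl = ∈-map⁺ f x∈xs

module ElementarySymmetric where

  open import Data.Nat as ℕ using (ℕ; zero; suc; s≤s)
  import Data.Nat.Properties as ℕ
  open import Data.Nat.ListAction using (product)
  open import Data.Integer using (ℤ; +_; 0ℤ; 1ℤ; _+_; _-_; _*_) renaming (_^_ to _^ᶻ_)
  open import Data.Integer.Properties using (*-zeroʳ; +-identityˡ; pos-*)
  open import Data.Integer.Divisibility.Signed as ℤᵈ using () renaming (_∣_ to _∣ᶻ_)
  open import Data.Integer.Tactic.RingSolver using (solve-∀)
  open import Data.List using (List; []; _∷_; map; length)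
  open import Data.List.Properties using (length-map)
  open import Data.List.Membership.Propositional using (_∈_)
  open import Data.List.Relation.Unary.Any using (here; there)
  open import Data.List.Relation.Binary.Permutation.Propositional as ↭ using (_↭_)
  open import Function using (_∘_)
  open import Relation.Binary.PropositionalEquality

  esym : ℕ → List ℤ → ℤ
  esym zero _ = 1ℤ
  esym (suc t) [] = 0ℤ
  esym (suc t) (x ∷ xs) = esym (suc t) xs + x * esym t xs

  esym-swap : ∀ t x y zs → esym t (x ∷ y ∷ zs) ≡ esym t (y ∷ x ∷ zs)
  esym-swap zero x y zs = refl
  esym-swap (suc zero) x y zs = a+y*1+x*1≡a+x*1+y*1 (esym 1 zs) x y
    where
    a+y*1+x*1≡a+x*1+y*1 : ∀ a x y → a + y * 1ℤ + x * 1ℤ ≡ a + x * 1ℤ + y * 1ℤ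
    a+y*1+x*1≡a+x*1+y*1 = solve-∀
  esym-swap (suc (suc t)) x y zs = expand (esym (suc (suc t)) zs) (esym (suc t) zs) (esym t zs) x y
    where
    expand : ∀ a b c x y → a + y * b + x * (b + y * c) ≡ a + x * b + y * (b + x * c)
    expand = solve-∀

  esym-∷ : ∀ x {xs ys} → (∀ t → esym t xs ≡ esym t ys) → ∀ t → esym t (x ∷ xs) ≡ esym t (x ∷ ys)
  esym-∷ x xs≈ys zero = refl
  esym-∷ x xs≈ys (suc t) = cong₂ (λ a b → a + x * b) (xs≈ys (suc t)) (xs≈ys t)

  esym-↭ : ∀ {xs ys} → xs ↭ ys → ∀ t → esym t xs ≡ esym t ys
  esym-↭ ↭.refl t = refl
  esym-↭ (↭.prep x xs↭ys) = esym-∷ x (esym-↭ xs↭ys)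
  esym-↭ (↭.swap x y xs↭ys) t = trans (esym-swap t x y _) (esym-∷ y (esym-∷ x (esym-↭ xs↭ys)) t)
  esym-↭ (↭.trans xs↭ys ys↭zs) t = trans (esym-↭ xs↭ys t) (esym-↭ ys↭zs t)

  esym-map-* : ∀ c t xs → esym t (map (c *_) xs) ≡ c ^ᶻ t * esym t xs
  esym-map-* c zero xs = refl
  esym-map-* c (suc t) [] = sym (*-zeroʳ (c ^ᶻ suc t))
  esym-map-* c (suc t) (x ∷ xs) rewrite esym-map-* c (suc t) xs | esym-map-* c t xs =
    expand c (c ^ᶻ t) x (esym (suc t) xs) (esym t xs)
    where
    expand : ∀ c cᵗ x a b → c * cᵗ * a + c * x * (cᵗ * b) ≡ c * cᵗ * (a + x * b)
    expand = solve-∀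

  esym-cong : ∀ {A : Set} m (g h : A → ℤ) xs → (∀ {x} → x ∈ xs → m ∣ᶻ g x - h x) →
              ∀ t → m ∣ᶻ esym t (map g xs) - esym t (map h xs)
  esym-cong m g h xs g≡h zero = ℤᵈ.divides 0ℤ refl
  esym-cong m g h [] g≡h (suc t) = ℤᵈ.divides 0ℤ refl
  esym-cong m g h (x ∷ xs) g≡h (suc t) = subst (m ∣ᶻ_)
    (regroup (esym (suc t) (map g xs)) (esym (suc t) (map h xs)) (esym t (map g xs)) (esym t (map h xs)) (g x) (h x))
    (ℤᵈ.∣m∣n⇒∣m+n (ℤᵈ.∣m∣n⇒∣m+n (esym-cong m g h xs (g≡h ∘ there) (suc t))
                                (ℤᵈ.∣n⇒∣m*n (esym t (map g xs)) (g≡h (here refl))))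
                  (ℤᵈ.∣n⇒∣m*n (h x) (esym-cong m g h xs (g≡h ∘ there) t)))
    where
    regroup : ∀ a a′ b b′ u v → (a - a′) + b * (u - v) + v * (b - b′) ≡ (a + u * b) - (a′ + v * b′)
    regroup = solve-∀

  esym-vanish : ∀ xs {t} → length xs ℕ.< t → esym t xs ≡ 0ℤ
  esym-vanish [] {suc t} _ = refl
  esym-vanish (x ∷ xs) {suc t} (s≤s n<t) rewrite esym-vanish xs (ℕ.m<n⇒m<1+n n<t) | esym-vanish xs n<t =
    trans (+-identityˡ _) (*-zeroʳ x)

  esym-length : ∀ ks → esym (length ks) (map +_ ks) ≡ + product ks
  esym-length [] = refl
  esym-length (k ∷ ks) = begin
    esym (suc n) (map +_ ks) + + k * esym n (map +_ ks)  ≡⟨ cong₂ (λ a b → a + + k * b) (esym-vanish (map +_ ks) n<1+n) (esym-length ks) ⟩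
    0ℤ + + k * + product ks                              ≡⟨ trans (+-identityˡ _) (sym (pos-* k (product ks))) ⟩
    + (k ℕ.* product ks)                                 ∎
    where
    open ≡-Reasoning
    n : ℕ
    n = length ks
    n<1+n : length (map +_ ks) ℕ.< suc n
    n<1+n = subst (ℕ._< suc n) (sym (length-map +_ ks)) ℕ.≤-refl

module NonMultiples where

  open import Data.Nat
  open import Data.Nat.Properties
  open import Data.Nat.Divisibility
  open import Data.List using (List; []; _∷_; length)
  open import Data.List.Membership.Propositional using (_∈_)
  import Data.List.Relation.Unary.All as All
  open import Data.List.Relation.Unary.Any using (here; there)
  open import Data.List.Relation.Unary.Unique.Propositional using (Unique; []; _∷_)
  open import Data.Product using (_×_; _,_; map₁; map₂)
  open import Data.Sum using (inj₁; inj₂)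
  open import Relation.Nullary using (¬_; yes; no; contradiction)
  open import Relation.Binary.PropositionalEquality

  -- the recursion of subsets in Defs, so that H p n s unfolds along it
  nonMultiples : ℕ → ℕ → List ℕ
  nonMultiples p zero = []
  nonMultiples p (suc n) with p ∣? suc n
  ... | yes _ = nonMultiples p n
  ... | no _ = suc n ∷ nonMultiples p n

  module _ {p : ℕ} where

    ∈-nonMultiples⁻ : ∀ {n k} → k ∈ nonMultiples p n → 1 ≤ k × k ≤ n × ¬ p ∣ k
    ∈-nonMultiples⁻ {suc n} k∈ with p ∣? suc n
    ∈-nonMultiples⁻ {suc n} k∈ | yes _ = map₂ (map₁ m≤n⇒m≤1+n) (∈-nonMultiples⁻ k∈)
    ∈-nonMultiples⁻ {suc n} (here refl) | no p∤n+1 = s≤s z≤n , ≤-refl , p∤n+1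
    ∈-nonMultiples⁻ {suc n} (there k∈) | no _ = map₂ (map₁ m≤n⇒m≤1+n) (∈-nonMultiples⁻ k∈)

    ∈-nonMultiples⁺ : ∀ {n k} → 1 ≤ k → k ≤ n → ¬ p ∣ k → k ∈ nonMultiples p n
    ∈-nonMultiples⁺ {zero} 1≤k k≤0 _ = contradiction (≤-trans 1≤k k≤0) λ ()
    ∈-nonMultiples⁺ {suc n} 1≤k k≤n+1 p∤k with m≤n⇒m<n∨m≡n k≤n+1 | p ∣? suc n
    ... | inj₁ (s≤s k≤n) | yes _ = ∈-nonMultiples⁺ 1≤k k≤n p∤k
    ... | inj₁ (s≤s k≤n) | no _ = there (∈-nonMultiples⁺ 1≤k k≤n p∤k)
    ... | inj₂ refl | yes p∣k = contradiction p∣k p∤k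
    ... | inj₂ refl | no _ = here refl

    nonMultiples-unique : ∀ n → Unique (nonMultiples p n)
    nonMultiples-unique zero = []
    nonMultiples-unique (suc n) with p ∣? suc n
    ... | yes _ = nonMultiples-unique n
    ... | no _ = All.tabulate (λ k∈ n+1≡k → let (_ , k≤n , _) = ∈-nonMultiples⁻ k∈ in 1+n≰n (subst (_≤ n) (sym n+1≡k) k≤n))
                 ∷ nonMultiples-unique n

    length-nonMultiples : ∀ {n} → n < p → length (nonMultiples p n) ≡ n
    length-nonMultiples {zero} _ = refl
    length-nonMultiples {suc n} n+1<p with p ∣? suc n
    ... | yes p∣n+1 = contradiction (∣⇒≤ p∣n+1) (<⇒≱ n+1<p)
    ... | no _ = cong suc (length-nonMultiples (<-trans (n<1+n n) n+1<p))

  length-nonMultiples[p] : ∀ q → length (nonMultiples (suc q) (suc q)) ≡ q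
  length-nonMultiples[p] q with suc q ∣? suc q
  ... | yes _ = length-nonMultiples ≤-refl
  ... | no q+1∤q+1 = contradiction ∣-refl q+1∤q+1

module ReducedResidues {p : ℕ} (p-prime : Prime p) (r : ℕ) where

  open import Data.Nat as ℕ using (ℕ; suc; _%_; NonZero)
  import Data.Nat.Properties as ℕ
  open import Data.Nat.DivMod using (m%n<n; m<n⇒m%n≡m)
  open import Data.Nat.Divisibility as ℕᵈ using (_∣_; divides; ∣-trans; m%n≡0⇒n∣m; ∣n∣m%n⇒∣m)
  open import Data.Nat.Primality using (prime⇒nonZero)
  open import Data.Nat.ListAction using (product)
  open import Data.Integer using (ℤ; +_; 1ℤ; _+_; _-_; _*_; -_; ∣_∣) renaming (_^_ to _^ᶻ_)
  open import Data.Integer.Properties using (pos-*; ^-distribˡ-+-*)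
  open import Data.Integer.Divisibility.Signed as ℤᵈ using (divides) renaming (_∣_ to _∣ᶻ_)
  open import Data.Integer.Tactic.RingSolver using (solve-∀)
  open import Data.List using (List; map; length)
  open import Data.List.Properties using (map-∘)
  open import Data.List.Membership.Propositional using (_∈_)
  import Data.List.Relation.Unary.All as All
  open import Data.List.Relation.Binary.Permutation.Propositional using (_↭_)
  import Data.List.Relation.Binary.Permutation.Propositional.Properties as ↭
  open import Data.Product using (Σ; _×_; _,_; proj₂)
  open import Data.Sum using (inj₁; inj₂)
  open import Function using (_∘_)
  open import Relation.Nullary using (¬_; contradiction)
  open import Relation.Binary.PropositionalEquality
  open ≡-Reasoning

  open PrimeDivisibility
  open IntegerDivisibility
  open ListPermutation
  open ElementarySymmetric
  open NonMultiples

  M : ℕ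
  M = p ^ suc r

  S : List ℕ
  S = nonMultiples p M

  N : ℕ
  N = length S

  instance
    p≢0 : NonZero p
    p≢0 = prime⇒nonZero p-prime
    M≢0 : NonZero M
    M≢0 = ℕ.m^n≢0 p (suc r)

  p∣M : p ∣ M
  p∣M = divides (p ^ r) (ℕ.*-comm p (p ^ r))

  S<M : ∀ {k} → k ∈ S → k ℕ.< M
  S<M k∈S with ∈-nonMultiples⁻ {p} {M} k∈S
  ... | _ , k≤M , p∤k with ℕ.m≤n⇒m<n∨m≡n k≤M
  ...   | inj₁ k<M = k<M
  ...   | inj₂ refl = contradiction p∣M p∤k

  p∤product[S] : ¬ p ∣ product S
  p∤product[S] = p∤product p-prime {S} (All.tabulate (proj₂ ∘ proj₂ ∘ ∈-nonMultiples⁻ {p} {M}))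

  mulMod : ℕ → ℕ → ℕ
  mulMod u k = (u ℕ.* k) % M

  mulMod-∈ : ∀ {u} → ¬ p ∣ u → ∀ {k} → k ∈ S → mulMod u k ∈ S
  mulMod-∈ {u} p∤u {k} k∈S = ∈-nonMultiples⁺ {p} {M} (ℕ.n≢0⇒n>0 uk%M≢0) (ℕ.<⇒≤ (m%n<n (u ℕ.* k) M)) p∤uk%M
    where
    p∤uk : ¬ p ∣ u ℕ.* k
    p∤uk = p∤m*n p-prime p∤u (proj₂ (proj₂ (∈-nonMultiples⁻ {p} {M} k∈S)))
    uk%M≢0 : mulMod u k ≢ 0
    uk%M≢0 uk%M≡0 = p∤uk (∣-trans p∣M (m%n≡0⇒n∣m (u ℕ.* k) M uk%M≡0))
    p∤uk%M : ¬ p ∣ mulMod u k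
    p∤uk%M p∣uk%M = p∤uk (∣n∣m%n⇒∣m p∣M p∣uk%M)

  M∣mulMod-* : ∀ u k → + M ∣ᶻ + mulMod u k - + u * + k
  M∣mulMod-* u k = subst (λ z → + M ∣ᶻ + mulMod u k - z) (pos-* u k) (n∣m%n-m (u ℕ.* k) M)

  mulMod-injective : ∀ {u} → ¬ p ∣ u → ∀ {a b} → a ∈ S → b ∈ S → mulMod u a ≡ mulMod u b → a ≡ b
  mulMod-injective {u} p∤u {a} {b} a∈S b∈S ua≡ub = begin
    a      ≡⟨ sym (m<n⇒m%n≡m (S<M a∈S)) ⟩
    a % M  ≡⟨ n∣m-o⇒m%n≡o%n M (p^k∣w*e⇒p^k∣e p-prime (suc r) {+ u} p∤u M∣u[a-b]) ⟩
    b % M  ≡⟨ m<n⇒m%n≡m (S<M b∈S) ⟩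
    b      ∎
    where
    reassociate : ∀ x u a b → (x - u * b) - (x - u * a) ≡ u * (a - b)
    reassociate = solve-∀
    M∣u[a-b] : + M ∣ᶻ + u * (+ a - + b)
    M∣u[a-b] = subst (+ M ∣ᶻ_)
      (trans (cong (λ z → (+ mulMod u b - + u * + b) - (+ z - + u * + a)) ua≡ub) (reassociate (+ mulMod u b) (+ u) (+ a) (+ b)))
                 (ℤᵈ.∣m∣n⇒∣m-n (M∣mulMod-* u b) (M∣mulMod-* u a))

  mulMod-surjective : ∀ {u} → ¬ p ∣ u → ∀ {k} → k ∈ S → Σ ℕ λ k′ → k′ ∈ S × mulMod u k′ ≡ k
  mulMod-surjective {u} p∤u {k} k∈S with inverse-mod-p^k p-prime p∤u (suc r)
  ... | v , M∣uv-1 = mulMod v k , mulMod-∈ p∤v k∈S , (begin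
    mulMod u (mulMod v k)  ≡⟨ n∣m-o⇒m%n≡o%n M M∣u[vk%M]-k ⟩
    k % M                  ≡⟨ m<n⇒m%n≡m (S<M k∈S) ⟩
    k                      ∎)
    where
    p∤v : ¬ p ∣ v
    p∤v p∣v = p∤1 p-prime (ℤᵈ.∣⇒∣ᵤ (subst (+ p ∣ᶻ_) (x-[x-1]≡1 (+ u * + v))
      (ℤᵈ.∣m∣n⇒∣m-n (subst (+ p ∣ᶻ_) (pos-* u v) (ℤᵈ.∣ᵤ⇒∣ (ℕᵈ.∣n⇒∣m*n u p∣v)))
                    (ℤᵈ.∣-trans (ℤᵈ.∣ᵤ⇒∣ p∣M) M∣uv-1))))
      where
      x-[x-1]≡1 : ∀ x → x - (x - 1ℤ) ≡ 1ℤ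
      x-[x-1]≡1 = solve-∀
    M∣u[vk%M]-k : + M ∣ᶻ + (u ℕ.* mulMod v k) - + k
    M∣u[vk%M]-k = subst (+ M ∣ᶻ_) regroup
      (ℤᵈ.∣m∣n⇒∣m+n (ℤᵈ.∣n⇒∣m*n (+ u) (M∣mulMod-* v k)) (ℤᵈ.∣n⇒∣m*n (+ k) M∣uv-1))
      where
      expand : ∀ u w v k → u * (w - v * k) + k * (u * v - 1ℤ) ≡ u * w - k
      expand = solve-∀
      regroup : + u * (+ mulMod v k - + v * + k) + + k * (+ u * + v - 1ℤ) ≡ + (u ℕ.* mulMod v k) - + k
      regroup = trans (expand (+ u) (+ mulMod v k) (+ v) (+ k)) (cong (_- + k) (sym (pos-* u (mulMod v k))))

  map-mulMod↭ : ∀ {u} → ¬ p ∣ u → map (mulMod u) S ↭ S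
  map-mulMod↭ p∤u = bijection⇒map↭ (nonMultiples-unique M) (mulMod-injective p∤u) (mulMod-∈ p∤u) (mulMod-surjective p∤u)

  esym-S : ℕ → ℤ
  esym-S t = esym t (map +_ S)

  M∣esym-S-u^t*esym-S : ∀ {u} → ¬ p ∣ u → ∀ t → + M ∣ᶻ esym-S t - (+ u) ^ᶻ t * esym-S t
  M∣esym-S-u^t*esym-S {u} p∤u t = subst (+ M ∣ᶻ_) (cong₂ _-_ permuted scaled)
    (esym-cong (+ M) (+_ ∘ mulMod u) (λ k → + u * + k) S (λ {k} _ → M∣mulMod-* u k) t)
    where
    permuted : esym t (map (+_ ∘ mulMod u) S) ≡ esym-S t
    permuted = trans (cong (esym t) (map-∘ S)) (esym-↭ (↭.map⁺ +_ (map-mulMod↭ p∤u)) t)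
    scaled : esym t (map (λ k → + u * + k) S) ≡ (+ u) ^ᶻ t * esym-S t
    scaled = trans (cong (esym t) (map-∘ S)) (esym-map-* (+ u) t (map +_ S))

  euler : ∀ {u} → ¬ p ∣ u → + M ∣ᶻ (+ u) ^ᶻ N - 1ℤ
  euler {u} p∤u = p^k∣w*e⇒p^k∣e p-prime (suc r) {+ product S} p∤product[S]
    (subst (+ M ∣ᶻ_) (trans (cong (λ P → - (P - (+ u) ^ᶻ N * P)) (esym-length S)) (factor (+ product S) ((+ u) ^ᶻ N)))
      (ℤᵈ.∣m⇒∣-m (M∣esym-S-u^t*esym-S p∤u N)))
    where
    factor : ∀ P x → - (P - x * P) ≡ P * (x - 1ℤ)
    factor = solve-∀

  M∣[u^s-1]*esym-S : ∀ {u} → ¬ p ∣ u → ∀ s t → s ℕ.+ t ≡ N → + M ∣ᶻ ((+ u) ^ᶻ s - 1ℤ) * esym-S t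
  M∣[u^s-1]*esym-S {u} p∤u s t s+t≡N = p^k∣w*e⇒p^k∣e p-prime (suc r) {(+ u) ^ᶻ t} p∤u^t
    (subst (+ M ∣ᶻ_) (trans (cong (λ x → (x - 1ℤ) * e + (e - (+ u) ^ᶻ t * e)) u^N≡u^t*u^s) (regroup ((+ u) ^ᶻ t) ((+ u) ^ᶻ s) e))
      (ℤᵈ.∣m∣n⇒∣m+n (ℤᵈ.∣m⇒∣m*n e (euler p∤u)) (M∣esym-S-u^t*esym-S p∤u t)))
    where
    e : ℤ
    e = esym-S t
    p∤u^t : ¬ p ∣ ∣ (+ u) ^ᶻ t ∣
    p∤u^t = subst (λ z → ¬ p ∣ ∣ z ∣) (pos-^ u t) (p∤m^n p-prime p∤u t)
    u^N≡u^t*u^s : (+ u) ^ᶻ N ≡ (+ u) ^ᶻ t * (+ u) ^ᶻ s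
    u^N≡u^t*u^s = trans (cong ((+ u) ^ᶻ_) (trans (sym s+t≡N) (ℕ.+-comm s t))) (^-distribˡ-+-* (+ u) t s)
    regroup : ∀ a b e → (a * b - 1ℤ) * e + (e - a * e) ≡ a * ((b - 1ℤ) * e)
    regroup = solve-∀

  p^[R∸d]∣esym-S : ∀ {u s d w} → ¬ p ∣ u → (+ u) ^ᶻ s - 1ℤ ≡ + (p ^ d) * w → ¬ p ∣ ∣ w ∣ →
                   ∀ {t} → s ℕ.+ t ≡ N → + (p ^ (suc r ∸ d)) ∣ᶻ esym-S t
  p^[R∸d]∣esym-S {u} {s} {d} {w} p∤u u^s-1≡p^d*w p∤w {t} s+t≡N = p^R∣p^d*w*e⇒p^[R∸d]∣e p-prime (suc r) d {w} p∤w
    (subst (λ x → + M ∣ᶻ x * esym-S t) u^s-1≡p^d*w (M∣[u^s-1]*esym-S p∤u s t s+t≡N))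

module FiniteDifferences where

  open import Data.Nat as ℕ using (ℕ; zero; suc; _!; s≤s; z≤n)
  import Data.Nat.Properties as ℕ
  open import Data.Integer using (ℤ; +_; 0ℤ; 1ℤ; _+_; _-_; _*_) renaming (_^_ to _^ᶻ_)
  open import Data.Integer.Properties using (+-inverseʳ; pos-*)
  open import Data.Integer.Divisibility.Signed as ℤᵈ using () renaming (_∣_ to _∣ᶻ_)
  open import Data.Integer.Tactic.RingSolver using (solve-∀)
  open import Relation.Binary.PropositionalEquality

  Δ : ℕ → (ℕ → ℤ) → ℕ → ℤ
  Δ zero f x = f x
  Δ (suc k) f x = Δ k f (suc x) - Δ k f x

  Δ-leibniz : ∀ k f x → Δ (suc k) (λ y → + y * f y) x ≡ + x * Δ (suc k) f x + + suc k * Δ k f (suc x)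
  Δ-leibniz zero f x = expand (+ x) (f (suc x)) (f x)
    where
    expand : ∀ x a b → (1ℤ + x) * a - x * b ≡ x * (a - b) + 1ℤ * a
    expand = solve-∀
  Δ-leibniz (suc k) f x = trans (cong₂ _-_ (Δ-leibniz k f (suc x)) (Δ-leibniz k f x))
    (regroup (+ x) (+ suc k) (Δ (suc k) f x) (Δ k f (suc (suc x))) (Δ k f (suc x)))
    where
    regroup : ∀ x k b c e → ((1ℤ + x) * (c - e) + k * c) - (x * b + k * e) ≡ x * ((c - e) - b) + (1ℤ + k) * (c - e)
    regroup = solve-∀

  Δ-const : ∀ k c x → Δ (suc k) (λ _ → c) x ≡ 0ℤ
  Δ-const zero c x = +-inverseʳ c
  Δ-const (suc k) c x = cong₂ _-_ (Δ-const k c (suc x)) (Δ-const k c x)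

  pow : ℕ → ℕ → ℤ
  pow j y = (+ y) ^ᶻ j

  Δ-pow-< : ∀ {j k} x → j ℕ.< k → Δ k (pow j) x ≡ 0ℤ
  Δ-pow-< {zero} {suc k} x _ = Δ-const k 1ℤ x
  Δ-pow-< {suc j} {suc k} x (s≤s j<k) = begin
    Δ (suc k) (pow (suc j)) x                                   ≡⟨ Δ-leibniz k (pow j) x ⟩
    + x * Δ (suc k) (pow j) x + + suc k * Δ k (pow j) (suc x)  ≡⟨ cong₂ (λ a b → + x * a + + suc k * b) (Δ-pow-< x (ℕ.m<n⇒m<1+n j<k)) (Δ-pow-< (suc x) j<k) ⟩
    + x * 0ℤ + + suc k * 0ℤ                                     ≡⟨ vanish (+ x) (+ suc k) ⟩
    0ℤ                                                          ∎
    where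
    open ≡-Reasoning
    vanish : ∀ a b → a * 0ℤ + b * 0ℤ ≡ 0ℤ
    vanish = solve-∀

  Δ-pow : ∀ j x → Δ j (pow j) x ≡ + (j !)
  Δ-pow zero x = refl
  Δ-pow (suc j) x = begin
    Δ (suc j) (pow (suc j)) x                                   ≡⟨ Δ-leibniz j (pow j) x ⟩
    + x * Δ (suc j) (pow j) x + + suc j * Δ j (pow j) (suc x)  ≡⟨ cong₂ (λ a b → + x * a + + suc j * b) (Δ-pow-< {j} x ℕ.≤-refl) (Δ-pow j (suc x)) ⟩
    + x * 0ℤ + + suc j * + (j !)                                ≡⟨ drop (+ x) (+ suc j) (+ (j !)) ⟩
    + suc j * + (j !)                                           ≡⟨ sym (pos-* (suc j) (j !)) ⟩
    + (suc j ! )                                                ∎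
    where
    open ≡-Reasoning
    drop : ∀ a b c → a * 0ℤ + b * c ≡ b * c
    drop = solve-∀

  Δ-∣ : ∀ k m g c x → (∀ i → i ℕ.≤ suc k → m ∣ᶻ g (x ℕ.+ i) - c) → m ∣ᶻ Δ (suc k) g x
  Δ-∣ zero m g c x g≡c = subst (m ∣ᶻ_) (cancel (g (suc x)) (g x) c)
    (ℤᵈ.∣m∣n⇒∣m-n (subst (λ y → m ∣ᶻ g y - c) (ℕ.+-comm x 1) (g≡c 1 (s≤s z≤n)))
                  (subst (λ y → m ∣ᶻ g y - c) (ℕ.+-identityʳ x) (g≡c 0 z≤n)))
    where
    cancel : ∀ a b c → (a - c) - (b - c) ≡ a - b
    cancel = solve-∀
  Δ-∣ (suc k) m g c x g≡c = ℤᵈ.∣m∣n⇒∣m-n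
    (Δ-∣ k m g c (suc x) (λ i i≤k+1 → subst (λ y → m ∣ᶻ g y - c) (ℕ.+-suc x i) (g≡c (suc i) (s≤s i≤k+1))))
    (Δ-∣ k m g c x (λ i i≤k+1 → g≡c i (ℕ.m≤n⇒m≤1+n i≤k+1)))

module LiftingTheExponent where

  open import Data.Nat as ℕ using (ℕ; zero; suc)
  import Data.Nat.Properties as ℕ
  open import Data.Nat.Divisibility using (_∣_)
  import Data.Nat.Tactic.RingSolver as ℕ-Solver
  open import Data.Integer using (ℤ; +_; 0ℤ; 1ℤ; _+_; _-_; _*_; ∣_∣) renaming (_^_ to _^ᶻ_)
  open import Data.Integer.Properties using (pos-*; pos-+; *-identityʳ; ^-*-assoc)
  open import Data.Integer.Tactic.RingSolver using (solve-∀)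
  open import Data.Product using (Σ; _×_; _,_)
  open import Relation.Nullary using (¬_)
  open import Relation.Binary.PropositionalEquality
  open ≡-Reasoning

  open IntegerDivisibility

  choose₂ : ℕ → ℕ
  choose₂ zero = 0
  choose₂ (suc n) = choose₂ n ℕ.+ n

  2*choose₂+n≡n*n : ∀ n → 2 ℕ.* choose₂ n ℕ.+ n ≡ n ℕ.* n
  2*choose₂+n≡n*n zero = refl
  2*choose₂+n≡n*n (suc n) = begin
    2 ℕ.* (choose₂ n ℕ.+ n) ℕ.+ suc n          ≡⟨ regroup (choose₂ n) n ⟩
    (2 ℕ.* choose₂ n ℕ.+ n) ℕ.+ (2 ℕ.* n ℕ.+ 1) ≡⟨ cong (ℕ._+ (2 ℕ.* n ℕ.+ 1)) (2*choose₂+n≡n*n n) ⟩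
    n ℕ.* n ℕ.+ (2 ℕ.* n ℕ.+ 1)                 ≡⟨ square (n) ⟩
    suc n ℕ.* suc n                              ∎
    where
    regroup : ∀ c n → 2 ℕ.* (c ℕ.+ n) ℕ.+ suc n ≡ (2 ℕ.* c ℕ.+ n) ℕ.+ (2 ℕ.* n ℕ.+ 1)
    regroup = ℕ-Solver.solve-∀
    square : ∀ n → n ℕ.* n ℕ.+ (2 ℕ.* n ℕ.+ 1) ≡ suc n ℕ.* suc n
    square = ℕ-Solver.solve-∀

  choose₂[2h+1] : ∀ h → choose₂ (suc (2 ℕ.* h)) ≡ suc (2 ℕ.* h) ℕ.* h
  choose₂[2h+1] h = ℕ.*-cancelˡ-≡ (choose₂ n) (n ℕ.* h) 2
    (ℕ.+-cancelʳ-≡ n (2 ℕ.* choose₂ n) (2 ℕ.* (n ℕ.* h)) (trans (2*choose₂+n≡n*n n) (square h)))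
    where
    n : ℕ
    n = suc (2 ℕ.* h)
    square : ∀ h → suc (2 ℕ.* h) ℕ.* suc (2 ℕ.* h) ≡ 2 ℕ.* (suc (2 ℕ.* h) ℕ.* h) ℕ.+ suc (2 ℕ.* h)
    square = ℕ-Solver.solve-∀

  binomial-cubic : ∀ Q W n → Σ ℤ λ y →
    (1ℤ + Q * W) ^ᶻ n ≡ 1ℤ + + n * Q * W + + choose₂ n * (Q * Q) * (W * W) + Q * Q * Q * y
  binomial-cubic Q W zero = 0ℤ , expand Q W
    where
    expand : ∀ Q W → 1ℤ ≡ 1ℤ + 0ℤ * Q * W + 0ℤ * (Q * Q) * (W * W) + Q * Q * Q * 0ℤ
    expand = solve-∀
  binomial-cubic Q W (suc n) with binomial-cubic Q W n
  ... | y , [1+QW]^n≡ = y + + choose₂ n * (W * W * W) + Q * W * y , (begin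
    (1ℤ + Q * W) * (1ℤ + Q * W) ^ᶻ n
      ≡⟨ cong ((1ℤ + Q * W) *_) [1+QW]^n≡ ⟩
    (1ℤ + Q * W) * (1ℤ + + n * Q * W + + choose₂ n * (Q * Q) * (W * W) + Q * Q * Q * y)
      ≡⟨ expand Q W (+ n) (+ choose₂ n) y ⟩
    1ℤ + (1ℤ + + n) * Q * W + (+ choose₂ n + + n) * (Q * Q) * (W * W) + Q * Q * Q * (y + + choose₂ n * (W * W * W) + Q * W * y)
      ≡⟨ cong₂ (λ a b → 1ℤ + a * Q * W + b * (Q * Q) * (W * W) + Q * Q * Q * (y + + choose₂ n * (W * W * W) + Q * W * y))
               (sym (pos-+ 1 n)) (sym (pos-+ (choose₂ n) n)) ⟩
    1ℤ + + suc n * Q * W + + choose₂ (suc n) * (Q * Q) * (W * W) + Q * Q * Q * (y + + choose₂ n * (W * W * W) + Q * W * y) ∎)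
    where
    expand : ∀ Q W n c y → (1ℤ + Q * W) * (1ℤ + n * Q * W + c * (Q * Q) * (W * W) + Q * Q * Q * y)
             ≡ 1ℤ + (1ℤ + n) * Q * W + (c + n) * (Q * Q) * (W * W) + Q * Q * Q * (y + c * (W * W * W) + Q * W * y)
    expand = solve-∀

  lte-base : ∀ {p b} → ¬ p ∣ b → Σ ℤ λ w → (+ suc p) ^ᶻ b - 1ℤ ≡ + (p ^ 1) * w × ¬ p ∣ ∣ w ∣
  lte-base {p} {b} p∤b with binomial-cubic (+ p) 1ℤ b
  ... | y , [1+p]^b≡ = + b + + p * (+ choose₂ b + + p * y) , (begin
    (+ suc p) ^ᶻ b - 1ℤ
      ≡⟨ cong (λ z → (1ℤ + z) ^ᶻ b - 1ℤ) (sym (*-identityʳ (+ p))) ⟩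
    (1ℤ + + p * 1ℤ) ^ᶻ b - 1ℤ
      ≡⟨ cong (_- 1ℤ) [1+p]^b≡ ⟩
    1ℤ + + b * + p * 1ℤ + + choose₂ b * (+ p * + p) * (1ℤ * 1ℤ) + + p * + p * + p * y - 1ℤ
      ≡⟨ factor (+ p) (+ b) (+ choose₂ b) y ⟩
    (+ p * 1ℤ) * (+ b + + p * (+ choose₂ b + + p * y))
      ≡⟨ cong (_* (+ b + + p * (+ choose₂ b + + p * y))) (sym (pos-* p 1)) ⟩
    + (p ^ 1) * (+ b + + p * (+ choose₂ b + + p * y)) ∎)
    , p∤w⇒p∤w+p*k (+ b) _ p∤b
    where
    factor : ∀ P B C Y → 1ℤ + B * P * 1ℤ + C * (P * P) * (1ℤ * 1ℤ) + P * P * P * Y - 1ℤ ≡ (P * 1ℤ) * (B + P * (C + P * Y))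
    factor = solve-∀

  module _ {p h : ℕ} (p≡2h+1 : p ≡ suc (2 ℕ.* h)) where

    -- p is odd, so p ∣ choose₂ p and the quadratic term is divisible by p^(a+3)
    lte-step : ∀ a w → ¬ p ∣ ∣ w ∣ →
               Σ ℤ λ w′ → (1ℤ + + (p ^ suc a) * w) ^ᶻ p - 1ℤ ≡ + (p ^ suc (suc a)) * w′ × ¬ p ∣ ∣ w′ ∣
    lte-step a w p∤w with binomial-cubic (+ (p ^ suc a)) w p
    ... | y , [1+Qw]^p≡ = w + + p * (+ h * R * w * w + R * R * y) , (begin
      (1ℤ + Q * w) ^ᶻ p - 1ℤ
        ≡⟨ cong (_- 1ℤ) [1+Qw]^p≡ ⟩
      1ℤ + + p * Q * w + + choose₂ p * (Q * Q) * (w * w) + Q * Q * Q * y - 1ℤ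
        ≡⟨ cong (λ c → 1ℤ + + p * Q * w + c * (Q * Q) * (w * w) + Q * Q * Q * y - 1ℤ) choose₂[p]≡p*h ⟩
      1ℤ + + p * Q * w + (+ p * + h) * (Q * Q) * (w * w) + Q * Q * Q * y - 1ℤ
        ≡⟨ cong (λ q → 1ℤ + + p * q * w + (+ p * + h) * (q * q) * (w * w) + q * q * q * y - 1ℤ) Q≡p*R ⟩
      1ℤ + + p * (+ p * R) * w + (+ p * + h) * ((+ p * R) * (+ p * R)) * (w * w) + (+ p * R) * (+ p * R) * (+ p * R) * y - 1ℤ
        ≡⟨ factor (+ p) R w (+ h) y ⟩
      + p * (+ p * R) * (w + + p * (+ h * R * w * w + R * R * y))
        ≡⟨ cong (_* (w + + p * (+ h * R * w * w + R * R * y))) (sym p^[a+2]≡p*p*R) ⟩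
      + (p ^ suc (suc a)) * (w + + p * (+ h * R * w * w + R * R * y)) ∎)
      , p∤w⇒p∤w+p*k w _ p∤w
      where
      R Q : ℤ
      R = + (p ^ a)
      Q = + (p ^ suc a)
      Q≡p*R : Q ≡ + p * R
      Q≡p*R = pos-* p (p ^ a)
      p^[a+2]≡p*p*R : + (p ^ suc (suc a)) ≡ + p * (+ p * R)
      p^[a+2]≡p*p*R = trans (pos-* p (p ^ suc a)) (cong (+ p *_) Q≡p*R)
      choose₂[p]≡p*h : + choose₂ p ≡ + p * + h
      choose₂[p]≡p*h = trans (cong (λ n → + choose₂ n) p≡2h+1)
        (trans (cong +_ (choose₂[2h+1] h)) (trans (pos-* (suc (2 ℕ.* h)) h) (cong (λ n → + n * + h) (sym p≡2h+1))))
      factor : ∀ P R W H y →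
        1ℤ + P * (P * R) * W + (P * H) * ((P * R) * (P * R)) * (W * W) + (P * R) * (P * R) * (P * R) * y - 1ℤ
        ≡ P * (P * R) * (W + P * (H * R * W * W + R * R * y))
      factor = solve-∀

    lte : ∀ a {b} → ¬ p ∣ b →
          Σ ℤ λ w → (+ suc p) ^ᶻ (p ^ a ℕ.* b) - 1ℤ ≡ + (p ^ suc a) * w × ¬ p ∣ ∣ w ∣
    lte zero {b} p∤b = subst (λ n → Σ ℤ λ w → (+ suc p) ^ᶻ n - 1ℤ ≡ + (p ^ 1) * w × ¬ p ∣ ∣ w ∣)
                             (sym (ℕ.*-identityˡ b)) (lte-base p∤b)
    lte (suc a) {b} p∤b =
      let (w , [1+p]^n-1≡ , p∤w) = lte a p∤b
          (w′ , step≡ , p∤w′) = lte-step a w p∤w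
      in w′ , (begin
      (+ suc p) ^ᶻ (p ^ suc a ℕ.* b) - 1ℤ    ≡⟨ cong (λ n → (+ suc p) ^ᶻ n - 1ℤ) (reassociate p (p ^ a) b) ⟩
      (+ suc p) ^ᶻ (p ^ a ℕ.* b ℕ.* p) - 1ℤ  ≡⟨ cong (_- 1ℤ) (sym (^-*-assoc (+ suc p) (p ^ a ℕ.* b) p)) ⟩
      ((+ suc p) ^ᶻ (p ^ a ℕ.* b)) ^ᶻ p - 1ℤ ≡⟨ cong (λ x → x ^ᶻ p - 1ℤ) (x-1≡y⇒x≡1+y [1+p]^n-1≡) ⟩
      (1ℤ + + (p ^ suc a) * w) ^ᶻ p - 1ℤ     ≡⟨ step≡ ⟩
      + (p ^ suc (suc a)) * w′               ∎) , p∤w′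
      where
      reassociate : ∀ p q b → p ℕ.* q ℕ.* b ≡ q ℕ.* b ℕ.* p
      reassociate = ℕ-Solver.solve-∀
      x-1≡y⇒x≡1+y : ∀ {x y} → x - 1ℤ ≡ y → x ≡ 1ℤ + y
      x-1≡y⇒x≡1+y {x} refl = sym (1+[x-1]≡x x)
        where
        1+[x-1]≡x : ∀ x → 1ℤ + (x - 1ℤ) ≡ x
        1+[x-1]≡x = solve-∀

module UnitChoice {q : ℕ} (p-prime : Prime (suc (suc q))) where

  open import Data.Nat as ℕ using (ℕ; zero; suc; _/_; _%_; s≤s; z≤n)
  import Data.Nat.Properties as ℕ
  open import Data.Nat.Divisibility as ℕᵈ using (_∣_; _∣?_; divides; m%n≡0⇒n∣m)
  open import Data.Nat.DivMod using (m%n<n; m≡m%n+[m/n]*n; m*n/n≡m)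
  open import Data.Fin using (Fin; toℕ; fromℕ<)
  open import Data.Fin.Properties using (¬∀⟶∃¬; toℕ<n; toℕ-fromℕ<)
  open import Data.Integer using (ℤ; +_; 1ℤ; _+_; _-_; _*_; ∣_∣) renaming (_^_ to _^ᶻ_)
  open import Data.Integer.Properties using (*-identityˡ; ^-distribˡ-+-*; ^-*-assoc)
  open import Data.Integer.Divisibility.Signed as ℤᵈ using () renaming (_∣_ to _∣ᶻ_)
  open import Data.Integer.Tactic.RingSolver using (solve-∀)
  open import Data.List using (length)
  open import Data.Product using (Σ; _×_; _,_)
  open import Relation.Nullary using (¬_; Dec; yes; no; contradiction)
  open import Relation.Binary.PropositionalEquality

  open PrimeDivisibility
  open IntegerDivisibility
  open NonMultiples
  open FiniteDifferences
  open LiftingTheExponent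

  -- p = q + 2, so that p - 1 is the literal successor suc q
  private
    p : ℕ
    p = suc (suc q)

  fermat : ∀ {u} → ¬ p ∣ u → + p ∣ᶻ (+ u) ^ᶻ suc q - 1ℤ
  fermat {u} p∤u = subst₂ (λ n N → + n ∣ᶻ (+ u) ^ᶻ N - 1ℤ) (ℕ.*-identityʳ p) N≡q+1 (euler p∤u)
    where
    open ReducedResidues p-prime 0
    N≡q+1 : N ≡ suc q
    N≡q+1 = trans (cong (λ n → length (nonMultiples p n)) (ℕ.*-identityʳ p)) (length-nonMultiples[p] (suc q))

  p∤[1+u] : ∀ {u} → suc u ℕ.< p → ¬ p ∣ suc u
  p∤[1+u] u+1<p p∣u+1 = ℕ.<⇒≱ u+1<p (ℕᵈ.∣⇒≤ p∣u+1)

  p∤1+p : ¬ p ∣ suc p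
  p∤1+p p∣1+p = p∤1 p-prime (ℕᵈ.∣m+n∣m⇒∣n (subst (p ∣_) (ℕ.+-comm 1 p) p∣1+p) ℕᵈ.∣-refl)

  non-root-of-unity : ∀ k → suc k ℕ.< suc q → Σ ℕ λ u → ¬ p ∣ u × ¬ (+ p ∣ᶻ (+ u) ^ᶻ suc k - 1ℤ)
  non-root-of-unity k k+1<q+1 with ¬∀⟶∃¬ (suc (suc k)) Root (λ i → + p ℤᵈ.∣? (pow (suc k) (suc (toℕ i)) - 1ℤ)) ¬all-roots
    where
    Root : Fin (suc (suc k)) → Set
    Root i = + p ∣ᶻ pow (suc k) (suc (toℕ i)) - 1ℤ
    ¬all-roots : ¬ (∀ i → Root i)
    ¬all-roots all-roots = ℕ.<⇒≱ (ℕ.<-trans k+1<q+1 (ℕ.n<1+n (suc q))) (p∣n!⇒p≤n p-prime (suc k) (ℤᵈ.∣⇒∣ᵤ p∣Δ))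
      where
      p∣Δ : + p ∣ᶻ + (suc k ℕ.!)
      p∣Δ = subst (+ p ∣ᶻ_) (Δ-pow (suc k) 1) (Δ-∣ k (+ p) (pow (suc k)) 1ℤ 1 λ i i≤k+1 →
        subst (λ j → + p ∣ᶻ pow (suc k) (suc j) - 1ℤ) (toℕ-fromℕ< (s≤s i≤k+1)) (all-roots (fromℕ< (s≤s i≤k+1))))
  ... | i , ¬root = suc (toℕ i) , p∤[1+u] (s≤s (ℕ.≤-trans (toℕ<n i) k+1<q+1)) , ¬root

  u^s≡u^[s%[p-1]] : ∀ {u} → ¬ p ∣ u → ∀ s → + p ∣ᶻ (+ u) ^ᶻ s - (+ u) ^ᶻ (s % suc q)
  u^s≡u^[s%[p-1]] {u} p∤u s = subst (+ p ∣ᶻ_) (sym u^s-u^t≡u^t*[Y-1]) (ℤᵈ.∣n⇒∣m*n (U ^ᶻ t) (∣x-1⇒∣x^n-1 (fermat p∤u) (s / suc q)))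
    where
    open ≡-Reasoning
    U Y : ℤ
    U = + u
    Y = (U ^ᶻ suc q) ^ᶻ (s / suc q)
    t : ℕ
    t = s % suc q
    factor : ∀ a y → a * y - a ≡ a * (y - 1ℤ)
    factor = solve-∀
    u^s-u^t≡u^t*[Y-1] : U ^ᶻ s - U ^ᶻ t ≡ U ^ᶻ t * (Y - 1ℤ)
    u^s-u^t≡u^t*[Y-1] = begin
      U ^ᶻ s - U ^ᶻ t                                 ≡⟨ cong (λ n → U ^ᶻ n - U ^ᶻ t) (m≡m%n+[m/n]*n s (suc q)) ⟩
      U ^ᶻ (t ℕ.+ s / suc q ℕ.* suc q) - U ^ᶻ t       ≡⟨ cong (_- U ^ᶻ t) (^-distribˡ-+-* U t _) ⟩
      U ^ᶻ t * U ^ᶻ (s / suc q ℕ.* suc q) - U ^ᶻ t    ≡⟨ cong (λ n → U ^ᶻ t * U ^ᶻ n - U ^ᶻ t) (ℕ.*-comm (s / suc q) (suc q)) ⟩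
      U ^ᶻ t * U ^ᶻ (suc q ℕ.* (s / suc q)) - U ^ᶻ t  ≡⟨ cong (λ x → U ^ᶻ t * x - U ^ᶻ t) (sym (^-*-assoc U (suc q) (s / suc q))) ⟩
      U ^ᶻ t * Y - U ^ᶻ t                             ≡⟨ factor (U ^ᶻ t) Y ⟩
      U ^ᶻ t * (Y - 1ℤ)                               ∎

  fermat-case : ∀ s → ¬ suc q ∣ s → Σ ℕ λ u → ¬ p ∣ u × ¬ (p ∣ ∣ (+ u) ^ᶻ s - 1ℤ ∣)
  fermat-case s q+1∤s = from-remainder (s % suc q) refl
    where
    cancel : ∀ x y → (x - 1ℤ) - (x - y) ≡ y - 1ℤ
    cancel = solve-∀
    from-remainder : ∀ t → s % suc q ≡ t → Σ ℕ λ u → ¬ p ∣ u × ¬ (p ∣ ∣ (+ u) ^ᶻ s - 1ℤ ∣)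
    from-remainder zero s%[q+1]≡0 = contradiction (m%n≡0⇒n∣m s (suc q) s%[q+1]≡0) q+1∤s
    from-remainder (suc k) s%[q+1]≡k+1 =
      let (u , p∤u , ¬p∣u^t-1) = non-root-of-unity k (subst (ℕ._< suc q) s%[q+1]≡k+1 (m%n<n s (suc q)))
      in u , p∤u , λ p∣u^s-1 → ¬p∣u^t-1 (subst (λ t → + p ∣ᶻ (+ u) ^ᶻ t - 1ℤ) s%[q+1]≡k+1
           (subst (+ p ∣ᶻ_) (cancel ((+ u) ^ᶻ s) ((+ u) ^ᶻ (s % suc q)))
             (ℤᵈ.∣m∣n⇒∣m-n (ℤᵈ.∣ᵤ⇒∣ {+ p} {(+ u) ^ᶻ s - 1ℤ} p∣u^s-1) (u^s≡u^[s%[p-1]] p∤u s))))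

  SmallValuationUnit : ℕ → Set
  SmallValuationUnit s = Σ ℕ λ u → ¬ p ∣ u × Σ ℕ λ d → Σ ℤ λ w →
    (+ u) ^ᶻ s - 1ℤ ≡ + (p ^ d) * w × ¬ p ∣ ∣ w ∣ × d ℕ.≤ s / suc q

  a<s/[p-1] : ∀ {a s} → 1 ℕ.≤ s → suc q ∣ s → p ^ a ∣ s → suc a ℕ.≤ s / suc q
  a<s/[p-1] {a} {s} 1≤s (divides m s≡m*[q+1]) p^a∣s = ℕ.≤-trans (n<m^n (ℕ.s≤s (ℕ.s≤s z≤n)) a)
    (subst (p ^ a ℕ.≤_) (sym (trans (cong (_/ suc q) s≡m*[q+1]) (m*n/n≡m m (suc q))))
      (ℕᵈ.∣⇒≤ {{m≢0}} (p^k∣m*n⇒p^k∣n p-prime (p∤[1+u] ℕ.≤-refl) a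
        (subst (p ^ a ∣_) (trans s≡m*[q+1] (ℕ.*-comm m (suc q))) p^a∣s))))
    where
    m≢0 : ℕ.NonZero m
    m≢0 = ℕ.≢-nonZero λ { refl → ℕ.<⇒≱ 1≤s (ℕ.≤-reflexive s≡m*[q+1]) }

  small-valuation-unit : 3 ℕ.≤ p → ∀ s → 1 ℕ.≤ s → SmallValuationUnit s
  small-valuation-unit 3≤p s 1≤s = by-divisibility (suc q ∣? s)
    where
    lift-the-exponent : suc q ∣ s → Σ ℕ (λ h → p ≡ suc (2 ℕ.* h)) →
                        Σ ℕ (λ a → Σ ℕ λ b → s ≡ p ^ a ℕ.* b × ¬ p ∣ b) → SmallValuationUnit s
    lift-the-exponent q+1∣s (h , p≡2h+1) (a , b , s≡p^a*b , p∤b) =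
      let (w , [1+p]^p^a*b-1≡ , p∤w) = lte {h = h} p≡2h+1 a p∤b
      in suc p , p∤1+p , suc a , w ,
         subst (λ n → (+ suc p) ^ᶻ n - 1ℤ ≡ + (p ^ suc a) * w) (sym s≡p^a*b) [1+p]^p^a*b-1≡ , p∤w ,
         a<s/[p-1] 1≤s q+1∣s (divides b (trans s≡p^a*b (ℕ.*-comm (p ^ a) b)))
    by-divisibility : Dec (suc q ∣ s) → SmallValuationUnit s
    by-divisibility (no q+1∤s) =
      let (u , p∤u , p∤u^s-1) = fermat-case s q+1∤s
      in u , p∤u , 0 , _ , sym (*-identityˡ _) , p∤u^s-1 , z≤n
    by-divisibility (yes q+1∣s) =
      lift-the-exponent q+1∣s (odd-prime p-prime 3≤p) (p-adic-decomposition p-prime s 1≤s)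

module RationalCongruences where

  open import Data.Nat as ℕ using (ℕ; suc)
  import Data.Nat.Properties as ℕ
  open import Data.Nat.Divisibility using (_∣_; ∣n⇒∣m*n; ∣-trans)
  open import Data.Nat.Primality using (euclidsLemma; ¬prime[1])
  open import Data.Nat.Coprimality using (recompute)
  open import Data.Integer as ℤ using (ℤ; +_; ∣_∣)
  import Data.Integer.Properties as ℤP
  open import Data.Integer.Divisibility.Signed as ℤᵈ using () renaming (_∣_ to _∣ᶻ_)
  open import Data.Integer.Tactic.RingSolver using (solve-∀)
  open import Data.Rational using (ℚ; mkℚ; 1ℚ; _+_; _*_; _/_; toℚᵘ; ↧_; ↧ₙ_)
  open import Data.Rational.Properties using (toℚᵘ-injective; toℚᵘ-fromℚᵘ; toℚᵘ-homo-+; toℚᵘ-homo-*; toℚᵘ-cong)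
  open import Data.Rational.Unnormalised as ℚᵘ using (mkℚᵘ; *≡*)
  import Data.Rational.Unnormalised.Properties as ℚᵘP
  open import Data.Product using (_,_)
  open import Data.Sum using (inj₁; inj₂)
  open import Relation.Nullary using (¬_)
  open import Relation.Binary.PropositionalEquality

  open PrimeDivisibility
  open IntegerDivisibility

  fromℤ : ℤ → ℚ
  fromℤ z = z / 1

  -- z / 1 computes to fromℚᵘ (mkℚᵘ z 0)
  toℚᵘ-fromℤ : ∀ z → toℚᵘ (fromℤ z) ℚᵘ.≃ mkℚᵘ z 0
  toℚᵘ-fromℤ z = toℚᵘ-fromℚᵘ (mkℚᵘ z 0)

  fromℤ-+ : ∀ a b → fromℤ (a ℤ.+ b) ≡ fromℤ a + fromℤ b
  fromℤ-+ a b = toℚᵘ-injective (begin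
    toℚᵘ (fromℤ (a ℤ.+ b))              ≈⟨ toℚᵘ-fromℤ (a ℤ.+ b) ⟩
    mkℚᵘ (a ℤ.+ b) 0                    ≈⟨ *≡* (expand a b) ⟩
    mkℚᵘ a 0 ℚᵘ.+ mkℚᵘ b 0              ≈⟨ ℚᵘP.+-cong (toℚᵘ-fromℤ a) (toℚᵘ-fromℤ b) ⟨
    toℚᵘ (fromℤ a) ℚᵘ.+ toℚᵘ (fromℤ b)  ≈⟨ toℚᵘ-homo-+ (fromℤ a) (fromℤ b) ⟨
    toℚᵘ (fromℤ a + fromℤ b)            ∎)
    where
    open ℚᵘP.≃-Reasoning
    expand : ∀ a b → (a ℤ.+ b) ℤ.* + 1 ≡ (a ℤ.* + 1 ℤ.+ b ℤ.* + 1) ℤ.* + 1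
    expand = solve-∀

  fromℤ-* : ∀ a b → fromℤ (a ℤ.* b) ≡ fromℤ a * fromℤ b
  fromℤ-* a b = toℚᵘ-injective (begin
    toℚᵘ (fromℤ (a ℤ.* b))              ≈⟨ toℚᵘ-fromℤ (a ℤ.* b) ⟩
    mkℚᵘ a 0 ℚᵘ.* mkℚᵘ b 0              ≈⟨ ℚᵘP.*-cong (toℚᵘ-fromℤ a) (toℚᵘ-fromℤ b) ⟨
    toℚᵘ (fromℤ a) ℚᵘ.* toℚᵘ (fromℤ b)  ≈⟨ toℚᵘ-homo-* (fromℤ a) (fromℤ b) ⟨
    toℚᵘ (fromℤ a * fromℤ b)            ∎)
    where
    open ℚᵘP.≃-Reasoning

  recip*fromℤ≡1 : ∀ k → recip (suc k) * fromℤ (+ suc k) ≡ 1ℚ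
  recip*fromℤ≡1 k = toℚᵘ-injective (begin
    toℚᵘ (recip (suc k) * fromℤ (+ suc k))                  ≈⟨ toℚᵘ-homo-* (recip (suc k)) (fromℤ (+ suc k)) ⟩
    toℚᵘ (recip (suc k)) ℚᵘ.* toℚᵘ (fromℤ (+ suc k))        ≈⟨ ℚᵘP.*-cong (toℚᵘ-fromℚᵘ (mkℚᵘ (+ 1) k)) (toℚᵘ-fromℤ (+ suc k)) ⟩
    mkℚᵘ (+ 1) k ℚᵘ.* mkℚᵘ (+ suc k) 0                       ≈⟨ *≡* (trans (ℤP.*-identityʳ _) (trans (ℤP.*-identityˡ (+ suc k))
                                                                  (trans (cong (λ z → + suc z) (sym (ℕ.*-identityʳ k))) (sym (ℤP.*-identityˡ _))))) ⟩
    mkℚᵘ (+ 1) 0                                             ∎)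
    where
    open ℚᵘP.≃-Reasoning

  ZeroMod-≤ : ∀ {p j k x} → j ℕ.≤ k → ZeroMod p k x → ZeroMod p j x
  ZeroMod-≤ {p} j≤k (p^k∣↥x , p∤↧x) = ∣-trans (m^n∣m^o p j≤k) p^k∣↥x , p∤↧x

  ZeroMod-fromℤ : ∀ {p} → Prime p → ∀ k {x P E} → ¬ p ∣ ∣ P ∣ → + (p ^ k) ∣ᶻ E →
                  x * fromℤ P ≡ fromℤ E → ZeroMod p k x
  ZeroMod-fromℤ {p} p-prime k {x@(mkℚ n d-1 n⊥d)} {P} {E} p∤P p^k∣E x*P≡E = p^k∣n , p∤d
    where
    n*P≡E*d : n ℤ.* P ≡ E ℤ.* ↧ x
    n*P≡E*d with ℚᵘP.≃-trans (ℚᵘP.≃-sym (ℚᵘP.≃-trans (toℚᵘ-homo-* x (fromℤ P)) (ℚᵘP.*-cong (ℚᵘP.≃-refl {toℚᵘ x}) (toℚᵘ-fromℤ P))))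
                             (ℚᵘP.≃-trans (toℚᵘ-cong x*P≡E) (toℚᵘ-fromℤ E))
    ... | *≡* eq = trans (sym (ℤP.*-identityʳ _)) (trans eq (cong (λ z → E ℤ.* + suc z) (ℕ.*-identityʳ _)))
    p^k∣n : p ^ k ∣ ∣ n ∣
    p^k∣n = ℤᵈ.∣⇒∣ᵤ (p^k∣w*e⇒p^k∣e p-prime k {P} p∤P
      (subst (+ (p ^ k) ∣ᶻ_) (trans (ℤP.*-comm (↧ x) E) (trans (sym n*P≡E*d) (ℤP.*-comm n P))) (ℤᵈ.∣n⇒∣m*n (↧ x) p^k∣E)))
    p∤d : ¬ p ∣ ↧ₙ x
    p∤d p∣d with euclidsLemma ∣ n ∣ ∣ P ∣ p-prime (subst (p ∣_) (trans (cong ∣_∣ (sym n*P≡E*d)) (ℤP.abs-* n P))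
                   (subst (p ∣_) (sym (ℤP.abs-* E (↧ x))) (∣n⇒∣m*n ∣ E ∣ p∣d)))
    ... | inj₁ p∣n = ¬prime[1] (subst Prime (recompute n⊥d (p∣n , p∣d)) p-prime)
    ... | inj₂ p∣P = p∤P p∣P

module ReciprocalSums where

  open import Data.Nat as ℕ using (ℕ; zero; suc; s≤s; z≤n)
  import Data.Nat.Properties as ℕ
  open import Data.Nat.Divisibility using (_∣_; _∣?_)
  open import Data.Nat.ListAction using (product)
  open import Data.Integer as ℤ using (+_)
  import Data.Integer.Properties as ℤP
  open import Data.Rational using (ℚ; 0ℚ; 1ℚ; _+_; _*_)
  open import Data.Rational.Properties
  open import Data.Rational.Solver using (module +-*-Solver)
  open import Data.List using (List; []; _∷_; _++_; map; filter; length)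
  open import Data.List.Properties using (filter-++; map-++)
  open import Data.List.Relation.Unary.All using (All; _∷_; all?)
  open import Relation.Nullary using (¬_; ¬?; yes; no; contradiction)
  open import Relation.Unary using (Decidable)
  open import Relation.Binary.PropositionalEquality
  open ≡-Reasoning

  open ElementarySymmetric
  open NonMultiples
  open RationalCongruences

  esymRecip : ℕ → List ℕ → ℚ
  esymRecip zero _ = 1ℚ
  esymRecip (suc s) [] = 0ℚ
  esymRecip (suc s) (k ∷ ks) = esymRecip (suc s) ks + recip k * esymRecip s ks

  sumℚ-++ : ∀ xs ys → sumℚ (xs ++ ys) ≡ sumℚ xs + sumℚ ys
  sumℚ-++ [] ys = sym (+-identityˡ _)
  sumℚ-++ (x ∷ xs) ys = trans (cong (_+_ x) (sumℚ-++ xs ys)) (sym (+-assoc x _ _))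

  sumℚ-map-recipProd-∷ : ∀ k ks → sumℚ (map recipProd (map (k ∷_) ks)) ≡ recip k * sumℚ (map recipProd ks)
  sumℚ-map-recipProd-∷ k [] = sym (*-zeroʳ (recip k))
  sumℚ-map-recipProd-∷ k (l ∷ ks) =
    trans (cong (_+_ (recip k * recipProd l)) (sumℚ-map-recipProd-∷ k ks)) (sym (*-distribˡ-+ (recip k) _ _))

  module _ (p : ℕ) where

    private
      p∤all? : Decidable (All (λ k → ¬ p ∣ k))
      p∤all? = all? (λ k → ¬? (p ∣? k))

    filter-∷-multiple : ∀ {k} → p ∣ k → ∀ ls → filter p∤all? (map (k ∷_) ls) ≡ []
    filter-∷-multiple {k} p∣k [] = refl
    filter-∷-multiple {k} p∣k (l ∷ ls) with p ∣? k
    ... | yes _ = filter-∷-multiple p∣k ls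
    ... | no p∤k = contradiction p∣k p∤k

    filter-∷-nonMultiple : ∀ {k} → ¬ p ∣ k → ∀ ls → filter p∤all? (map (k ∷_) ls) ≡ map (k ∷_) (filter p∤all? ls)
    filter-∷-nonMultiple {k} p∤k [] = refl
    filter-∷-nonMultiple {k} p∤k (l ∷ ls) with p ∣? k
    ... | yes p∣k = contradiction p∣k p∤k
    ... | no _ with p∤all? l
    ...   | yes _ = cong ((k ∷ l) ∷_) (filter-∷-nonMultiple p∤k ls)
    ...   | no _ = filter-∷-nonMultiple p∤k ls

    H≡esymRecip : ∀ n s → H p n s ≡ esymRecip s (nonMultiples p n)
    H≡esymRecip n zero = +-identityʳ 1ℚ
    H≡esymRecip zero (suc s) = refl
    H≡esymRecip (suc n) (suc s) = begin
      sumℚ (map recipProd (filter p∤all? (subsets n (suc s) ++ map (suc n ∷_) (subsets n s))))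
        ≡⟨ cong (λ z → sumℚ (map recipProd z)) (filter-++ p∤all? (subsets n (suc s)) _) ⟩
      sumℚ (map recipProd (filter p∤all? (subsets n (suc s)) ++ filter p∤all? (map (suc n ∷_) (subsets n s))))
        ≡⟨ cong sumℚ (map-++ recipProd (filter p∤all? (subsets n (suc s))) _) ⟩
      sumℚ (map recipProd (filter p∤all? (subsets n (suc s))) ++ map recipProd (filter p∤all? (map (suc n ∷_) (subsets n s))))
        ≡⟨ sumℚ-++ (map recipProd (filter p∤all? (subsets n (suc s)))) _ ⟩
      H p n (suc s) + sumℚ (map recipProd (filter p∤all? (map (suc n ∷_) (subsets n s))))
        ≡⟨ cong (_+ sumℚ (map recipProd (filter p∤all? (map (suc n ∷_) (subsets n s))))) (H≡esymRecip n (suc s)) ⟩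
      esymRecip (suc s) (nonMultiples p n) + sumℚ (map recipProd (filter p∤all? (map (suc n ∷_) (subsets n s))))
        ≡⟨ new-term ⟩
      esymRecip (suc s) (nonMultiples p (suc n)) ∎
      where
      new-term : esymRecip (suc s) (nonMultiples p n) + sumℚ (map recipProd (filter p∤all? (map (suc n ∷_) (subsets n s))))
                 ≡ esymRecip (suc s) (nonMultiples p (suc n))
      new-term with p ∣? suc n
      ... | yes p∣n+1 = trans (cong (λ z → esymRecip (suc s) (nonMultiples p n) + sumℚ (map recipProd z))
                                    (filter-∷-multiple p∣n+1 (subsets n s)))
                              (+-identityʳ _)
      ... | no p∤n+1 = cong (_+_ (esymRecip (suc s) (nonMultiples p n))) (begin
        sumℚ (map recipProd (filter p∤all? (map (suc n ∷_) (subsets n s))))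
          ≡⟨ cong (λ z → sumℚ (map recipProd z)) (filter-∷-nonMultiple p∤n+1 (subsets n s)) ⟩
        sumℚ (map recipProd (map (suc n ∷_) (filter p∤all? (subsets n s))))
          ≡⟨ sumℚ-map-recipProd-∷ (suc n) (filter p∤all? (subsets n s)) ⟩
        recip (suc n) * H p n s
          ≡⟨ cong (recip (suc n) *_) (H≡esymRecip n s) ⟩
        recip (suc n) * esymRecip s (nonMultiples p n) ∎)

  esymRecip-vanish : ∀ ks {s} → length ks ℕ.< s → esymRecip s ks ≡ 0ℚ
  esymRecip-vanish [] {suc s} _ = refl
  esymRecip-vanish (k ∷ ks) {suc s} (s≤s n<s)
    rewrite esymRecip-vanish ks (ℕ.m<n⇒m<1+n n<s) | esymRecip-vanish ks n<s =
    trans (+-identityˡ _) (*-zeroʳ (recip k))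

  esymRecip*product : ∀ ks → All (1 ℕ.≤_) ks → ∀ s j → s ℕ.+ j ≡ length ks →
                      esymRecip s ks * fromℤ (+ product ks) ≡ fromℤ (esym j (map +_ ks))
  esymRecip*product ks _ zero j j≡n = trans (*-identityˡ _)
    (cong fromℤ (sym (trans (cong (λ n → esym n (map +_ ks)) j≡n) (esym-length ks))))
  esymRecip*product (suc k ∷ ks) (s≤s z≤n ∷ 1≤ks) (suc s) j s+j≡n = begin
    (a + r * b) * fromℤ (+ (suc k ℕ.* product ks))
      ≡⟨ cong ((a + r * b) *_) (trans (cong fromℤ (ℤP.pos-* (suc k) (product ks))) (fromℤ-* (+ suc k) (+ product ks))) ⟩
    (a + r * b) * (K * P)            ≡⟨ distribute a P K r b ⟩
    K * (a * P) + (r * K) * (b * P)  ≡⟨ cong (λ z → K * (a * P) + z * (b * P)) (recip*fromℤ≡1 k) ⟩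
    K * (a * P) + 1ℚ * (b * P)       ≡⟨ cong (_+_ (K * (a * P))) (*-identityˡ (b * P)) ⟩
    K * (a * P) + b * P              ≡⟨ by-complement-size j s+j≡n ⟩
    fromℤ (esym j (map +_ (suc k ∷ ks))) ∎
    where
    a b r K P : ℚ
    a = esymRecip (suc s) ks
    b = esymRecip s ks
    r = recip (suc k)
    K = fromℤ (+ suc k)
    P = fromℤ (+ product ks)
    distribute : ∀ a P K r b → (a + r * b) * (K * P) ≡ K * (a * P) + (r * K) * (b * P)
    distribute = solve 5 (λ a P K r b → (a :+ r :* b) :* (K :* P) := K :* (a :* P) :+ (r :* K) :* (b :* P)) refl
      where open +-*-Solver
    by-complement-size : ∀ j → suc s ℕ.+ j ≡ suc (length ks) → K * (a * P) + b * P ≡ fromℤ (esym j (map +_ (suc k ∷ ks)))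
    by-complement-size zero s+1≡n+1 = begin
      K * (a * P) + b * P   ≡⟨ cong (λ z → K * (z * P) + b * P) (esymRecip-vanish ks (s≤s (ℕ.≤-reflexive n≡s))) ⟩
      K * (0ℚ * P) + b * P  ≡⟨ cong (λ z → K * z + b * P) (*-zeroˡ P) ⟩
      K * 0ℚ + b * P        ≡⟨ cong (_+ b * P) (*-zeroʳ K) ⟩
      0ℚ + b * P            ≡⟨ +-identityˡ (b * P) ⟩
      b * P                 ≡⟨ esymRecip*product ks 1≤ks s zero (ℕ.suc-injective s+1≡n+1) ⟩
      fromℤ (esym zero (map +_ ks)) ∎
      where
      n≡s : length ks ≡ s
      n≡s = sym (trans (sym (ℕ.+-identityʳ s)) (ℕ.suc-injective s+1≡n+1))
    by-complement-size (suc j) s+j+1≡n+1 = begin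
      K * (a * P) + b * P
        ≡⟨ cong₂ (λ x y → K * x + y)
             (esymRecip*product ks 1≤ks (suc s) j (trans (sym (ℕ.+-suc s j)) (ℕ.suc-injective s+j+1≡n+1)))
             (esymRecip*product ks 1≤ks s (suc j) (ℕ.suc-injective s+j+1≡n+1)) ⟩
      K * fromℤ (esym j (map +_ ks)) + fromℤ (esym (suc j) (map +_ ks))
        ≡⟨ trans (+-comm (K * fromℤ (esym j (map +_ ks))) (fromℤ (esym (suc j) (map +_ ks)))) (cong (_+_ (fromℤ (esym (suc j) (map +_ ks)))) (sym (fromℤ-* (+ suc k) (esym j (map +_ ks))))) ⟩
      fromℤ (esym (suc j) (map +_ ks)) + fromℤ (+ suc k ℤ.* esym j (map +_ ks))
        ≡⟨ sym (fromℤ-+ (esym (suc j) (map +_ ks)) _) ⟩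
      fromℤ (esym (suc j) (map +_ ks) ℤ.+ + suc k ℤ.* esym j (map +_ ks)) ∎

module ReciprocalSumsModPrimePower {p : ℕ} (p-prime : Prime p) (r : ℕ) where

  open import Data.Nat as ℕ using (ℕ; suc; _≤?_)
  import Data.Nat.Properties as ℕ
  open import Data.Nat.Divisibility using (_∣_)
  open import Data.Nat.ListAction using (product)
  open import Data.Integer as ℤ using (+_; 0ℤ; 1ℤ; _-_; ∣_∣) renaming (_^_ to _^ᶻ_)
  open import Data.Integer.Divisibility.Signed as ℤᵈ using ()
  open import Data.Rational using (ℚ; _*_)
  open import Data.Rational.Properties using (*-zeroˡ)
  import Data.List.Relation.Unary.All as All
  open import Data.Product using (proj₁)
  open import Function using (_∘_)
  open import Relation.Nullary using (¬_; Dec; yes; no)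
  open import Relation.Binary.PropositionalEquality

  open NonMultiples
  open ReducedResidues p-prime r
  open RationalCongruences
  open ReciprocalSums

  esymRecip-S-ZeroMod : ∀ s {u d w k} → ¬ p ∣ u → (+ u) ^ᶻ s - 1ℤ ≡ + (p ^ d) ℤ.* w → ¬ p ∣ ∣ w ∣ →
                        k ℕ.≤ suc r ∸ d → ZeroMod p k (esymRecip s S)
  esymRecip-S-ZeroMod s {u} {d} {w} p∤u u^s-1≡p^d*w p∤w k≤R∸d =
    ZeroMod-≤ {x = esymRecip s S} k≤R∸d (by-size (s ≤? N))
    where
    P : ℚ
    P = fromℤ (+ product S)
    by-size : Dec (s ℕ.≤ N) → ZeroMod p (suc r ∸ d) (esymRecip s S)
    by-size (no s≰N) = ZeroMod-fromℤ p-prime (suc r ∸ d) {esymRecip s S} {+ product S} {0ℤ}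
      p∤product[S] (ℤᵈ.divides 0ℤ refl)
      (trans (cong (_* P) (esymRecip-vanish S (ℕ.≰⇒> s≰N))) (*-zeroˡ P))
    by-size (yes s≤N) = ZeroMod-fromℤ p-prime (suc r ∸ d) {esymRecip s S} {+ product S} {esym-S (N ∸ s)}
      p∤product[S] (p^[R∸d]∣esym-S {u} {s} {d} {w} p∤u u^s-1≡p^d*w p∤w (ℕ.m+[n∸m]≡n s≤N))
      (esymRecip*product S (All.tabulate (proj₁ ∘ ∈-nonMultiples⁻ {p} {M})) s (N ∸ s) (ℕ.m+[n∸m]≡n s≤N))

open import Data.Nat using (_/_)
import Data.Nat.Properties as ℕ
open import Data.Product using (_,_)
open import Relation.Binary.PropositionalEquality using (subst; sym)

open NonMultiples using (nonMultiples)
open ReciprocalSums using (esymRecip; H≡esymRecip)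

-- The argument works for every s ≥ 1.
lemmaA2 : (p r s : ℕ) → Prime p → 3 ≤ p → 1 ≤ r → 1 ≤ s → s < p ^ r →
          ZeroMod p (r ∸ η p s) (H p (p ^ r) s)
lemmaA2 (suc (suc q)) (suc r) s p-prime 3≤p _ 1≤s _ =
  subst (ZeroMod p (suc r ∸ η p s)) (sym (H≡esymRecip p (p ^ suc r) s))
    (from-unit (small-valuation-unit 3≤p s 1≤s))
  where
  p : ℕ
  p = suc (suc q)
  open UnitChoice p-prime using (SmallValuationUnit; small-valuation-unit)
  open ReciprocalSumsModPrimePower p-prime r using (esymRecip-S-ZeroMod)
  from-unit : SmallValuationUnit s → ZeroMod p (suc r ∸ η p s) (esymRecip s (nonMultiples p (p ^ suc r)))
  from-unit (u , p∤u , d , w , u^s-1≡p^d*w , p∤w , d≤s/[p-1]) = esymRecip-S-ZeroMod s {u} {d} {w} p∤u u^s-1≡p^d*w p∤w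
    (ℕ.∸-monoʳ-≤ (suc r) (ℕ.≤-trans d≤s/[p-1] (ℕ.m≤m+n (s / suc q) _)))
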